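{- Let $n=3k+r$ with integers $k\ge 2$ and $r\in\{0,1,2\}$. Then $$\gamma_{LD}(M(P_n))\le\begin{cases}2k+1 & \text{if } r=0,\\ 2k+2 & \text{if } r\in\{1,2\}.\end{cases}$$ Moreover, for every $n\ge 3$, $$\gamma_{LD}(M(C_n))\le\begin{cases} n-\left\lfloor\frac n3\right\rfloor+1 & \text{if } n \text{ is odd},\\ n-2\left\lfloor\frac n6\right\rfloor+1 & \text{if } n \text{ is even}.\end{cases}$$
   Context: All graphs are finite, simple and connected. For a graph $G=(V,E)$ and $x\in V$, $N(x)$ is the open neighbourhood and $N[x]=N(x)\cup\{x\}$. A set $C\subseteq V$ is a locating-dominating set ($LD$-set) if $N[x]\cap C\neq\emptyset$ for all $x\in V$ and $N(x)\cap C\neq N(y)\cap C$ for all distinct $x,y\in V\setminus C$; $\gamma_{LD}(G)$ is the minimum size of an $LD$-set. $P_n$ is the path and $C_n$ the cycle on $n$ vertices. The Mycielski graph $M(G)$ of $G$ with $V=\{v_1,\dots,v_n\}$ is obtained from $G$ by adding, for each $i$, a new vertex $u_i$ adjacent to every vertex of $N_G(v_i)$, and then adding one further vertex $u$ adjacent to all of $u_1,\dots,u_n$ (and to nothing else). -}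

module Defs where

open import Data.Nat using (ℕ; zero; suc; _+_; _*_; _∸_; _≤_; _≡ᵇ_)
open import Data.Nat.DivMod using (_/_; _%_)
open import Data.Fin using (Fin; toℕ)
open import Data.Bool using (Bool; true; false; _∨_; _∧_)
open import Data.List using (List; length)
open import Data.List.Membership.Propositional using (_∈_; _∉_)
open import Data.List.Relation.Unary.Unique.Propositional using (Unique)
open import Data.Product using (Σ; ∃; _×_)
open import Data.Sum using (_⊎_)
open import Relation.Binary.PropositionalEquality using (_≡_; _≢_)

record Graph : Set₁ where
  field
    Vtx : Set
    adj : Vtx → Vtx → Bool
open Graph public

P : ℕ → Graph
P n = record { Vtx = Fin n
             ; adj = λ i j → (suc (toℕ i) ≡ᵇ toℕ j) ∨ (suc (toℕ j) ≡ᵇ toℕ i) }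

C : ℕ → Graph
C n = record { Vtx = Fin n
             ; adj = λ i j → (suc (toℕ i) ≡ᵇ toℕ j) ∨ (suc (toℕ j) ≡ᵇ toℕ i)
                             ∨ ((toℕ i ≡ᵇ 0) ∧ (toℕ j ≡ᵇ (n ∸ 1)))
                             ∨ ((toℕ j ≡ᵇ 0) ∧ (toℕ i ≡ᵇ (n ∸ 1))) }

-- Vertices of the Mycielski graph: v_i (original), u_i (shadow), u (apex).
data MVtx (V : Set) : Set where
  orig   : V → MVtx V
  shadow : V → MVtx V
  apex   : MVtx V

Mycielski : Graph → Graph
Mycielski G = record { Vtx = MVtx (Vtx G) ; adj = a }
  where
  a : MVtx (Vtx G) → MVtx (Vtx G) → Bool
  a (orig x)   (orig y)   = adj G x y
  a (orig x)   (shadow y) = adj G x y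
  a (shadow x) (orig y)   = adj G x y
  a (shadow x) (shadow y) = false
  a (shadow x) apex       = true
  a apex       (shadow y) = true
  a (orig x)   apex       = false
  a apex       (orig y)   = false
  a apex       apex       = false

IsLDSet : (G : Graph) → List (Vtx G) → Set
IsLDSet G Cs =
  (∀ x → x ∈ Cs ⊎ (∃ λ c → c ∈ Cs × adj G x c ≡ true))
  × (∀ x y → x ∉ Cs → y ∉ Cs → x ≢ y → ∃ λ c → c ∈ Cs × adj G x c ≢ adj G y c)

γLD≤ : Graph → ℕ → Set
γLD≤ G m = ∃ λ (Cs : List (Vtx G)) → Unique Cs × IsLDSet G Cs × length Cs ≤ m

pathBound : ℕ → ℕ → ℕ
pathBound k zero    = 2 * k + 1
pathBound k (suc _) = 2 * k + 2

cycleBound : ℕ → ℕ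
cycleBound n with n % 2
... | zero  = n ∸ 2 * (n / 6) + 1
... | suc _ = n ∸ (n / 3) + 1

module Submission where

-- For n ≥ 5 let S consist of the vertices i ≥ 1 with i ≢ 2 (mod 3), plus one extra vertex near the right
-- end. In P_n and in C_n every vertex except 1 (which lies in S) has a neighbour in S, and two distinct
-- vertices with a common neighbour in S are at distance two, so a vertex of S just beyond them separates
-- them; hence S dominates G and separates all pairs of vertices by their open neighbourhoods. Adding the
-- apex u, adjacent to every shadow and to no original vertex, makes S an LD-set of M(G) of size |S| + 1,
-- and |S| ≤ 2k + [r ≠ 0] for n = 3k + r. The cycles C₃ and C₄ are settled by a finite check.

open import Defs
open import Data.Bool using (Bool; true; false; T; _∨_)
import Data.Bool.Properties as Bool
open import Data.Empty using (⊥-elim)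
open import Data.Fin using (Fin; toℕ; fromℕ<; #_)
import Data.Fin as Fin
open import Data.Fin.Properties using (toℕ<n; toℕ-fromℕ<; toℕ-injective)
open import Data.List using (List; []; _∷_; _++_; length; map; filterᵇ; tabulate; allFin)
open import Data.List.Properties using (length-map)
open import Data.List.Membership.Propositional using (_∈_; _∉_; find; lose)
open import Data.List.Membership.Propositional.Properties
  using (∈-map⁺; ∈-map⁻; ∈-filter⁺; ∈-allFin; ∈-++⁺ˡ; ∈-++⁺ʳ)
import Data.List.Membership.DecPropositional as DecMembership
open import Data.List.Relation.Unary.Any using (here; there; any?)
import Data.List.Relation.Unary.All as All
open import Data.List.Relation.Unary.AllPairs using (_∷_)
open import Data.List.Relation.Unary.Unique.Propositional using (Unique)
open import Data.List.Relation.Unary.Unique.Propositional.Properties using (map⁺; filter⁺; allFin⁺)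
open import Data.List.Relation.Unary.Unique.DecPropositional using (unique?)
open import Data.Nat using (ℕ; zero; suc; _+_; _*_; _∸_; _≤_; _<_; _≡ᵇ_; z≤n; s≤s)
open import Data.Nat.Properties
open import Data.Nat.DivMod using (_/_; _%_; m≡m%n+[m/n]*n; m%n<n; m/n*n≤m; m/n/o≡m/[n*o]; m≥n⇒m/n>0)
open import Data.Product as Product using (∃; _×_; _,_; proj₁; proj₂)
open import Data.Sum as Sum using (_⊎_; inj₁; inj₂)
open import Function using (_∘_; id; Equivalence)
open import Relation.Binary.Definitions using (Decidable; DecidableEquality)
open import Relation.Binary.PropositionalEquality
  using (_≡_; _≢_; refl; sym; trans; cong; cong₂; subst; module ≡-Reasoning)
open import Relation.Nullary using (¬_; Dec; yes; no; does)
open import Relation.Nullary.Decidable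
  using (T?; map′; ¬?; _⊎-dec_; _×-dec_; _→-dec_; dec-true; dec-false; from-yes)

γLD≤-weaken : ∀ {G m m′} → m ≤ m′ → γLD≤ G m → γLD≤ G m′
γLD≤-weaken m≤m′ (Cs , unique , ld , length≤m) = Cs , unique , ld , ≤-trans length≤m m≤m′

-- Locating-dominating sets of M(G) containing the apex

Dominates : (G : Graph) → List (Vtx G) → Set
Dominates G S = ∀ x → x ∈ S ⊎ ∃ λ c → c ∈ S × adj G x c ≡ true

Separates : (G : Graph) → List (Vtx G) → Set
Separates G S = ∀ x y → x ≢ y → ∃ λ c → c ∈ S × adj G x c ≢ adj G y c

orig-injective : ∀ {V} {x y : V} → orig x ≡ orig y → x ≡ y
orig-injective refl = refl

-- Shadows of vertices of S are outside the set, so S has to separate all pairs of vertices of G.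
mycielski-ldSet : ∀ G {S : List (Vtx G)} → Unique S → Dominates G S → Separates G S →
                  γLD≤ (Mycielski G) (suc (length S))
mycielski-ldSet G {S} unique dominates separates =
  Cs , unique-Cs , (dominating , locating) , ≤-reflexive (cong suc (length-map orig S))
  where
  Cs : List (MVtx (Vtx G))
  Cs = apex ∷ map orig S

  orig∈Cs : ∀ {x} → x ∈ S → orig x ∈ Cs
  orig∈Cs = there ∘ ∈-map⁺ orig

  apex∉origS : apex ∉ map orig S
  apex∉origS apex∈ with ∈-map⁻ orig apex∈
  ... | _ , _ , ()

  unique-Cs : Unique Cs
  unique-Cs = All.tabulate (λ { x∈ refl → apex∉origS x∈ }) ∷ map⁺ orig-injective unique

  dominating : ∀ x → x ∈ Cs ⊎ ∃ λ c → c ∈ Cs × adj (Mycielski G) x c ≡ true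
  dominating (orig x)   = Sum.map orig∈Cs (λ (c , c∈S , xc) → orig c , orig∈Cs c∈S , xc) (dominates x)
  dominating (shadow x) = inj₂ (apex , here refl , refl)
  dominating apex       = inj₁ (here refl)

  locating : ∀ x y → x ∉ Cs → y ∉ Cs → x ≢ y →
             ∃ λ c → c ∈ Cs × adj (Mycielski G) x c ≢ adj (Mycielski G) y c
  locating apex _ apex∉ _ _ = ⊥-elim (apex∉ (here refl))
  locating _ apex _ apex∉ _ = ⊥-elim (apex∉ (here refl))
  locating (orig x) (orig y) _ _ x≢y =
    let c , c∈S , sep = separates x y (x≢y ∘ cong orig) in orig c , orig∈Cs c∈S , sep
  locating (shadow x) (shadow y) _ _ x≢y =
    let c , c∈S , sep = separates x y (x≢y ∘ cong shadow) in orig c , orig∈Cs c∈S , sep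
  locating (orig x) (shadow y) _ _ _ = apex , here refl , λ ()
  locating (shadow x) (orig y) _ _ _ = apex , here refl , λ ()

-- Graphs on {0, …, n-1} given by a decidable relation on ℕ

ℕGraph : (n : ℕ) {R : ℕ → ℕ → Set} → Decidable R → Graph
ℕGraph n R? = record { Vtx = Fin n ; adj = λ i j → does (R? (toℕ i) (toℕ j)) }

below : (n : ℕ) → (ℕ → Bool) → List (Fin n)
below n f = filterᵇ (f ∘ toℕ) (allFin n)

sucIf : Bool → ℕ → ℕ
sucIf true  = suc
sucIf false = id

count : (ℕ → Bool) → ℕ → ℕ
count f zero    = 0
count f (suc n) = sucIf (f n) (count f n)

sucIf-comm : ∀ a b x → sucIf a (sucIf b x) ≡ sucIf b (sucIf a x)
sucIf-comm true  true  _ = refl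
sucIf-comm true  false _ = refl
sucIf-comm false _     _ = refl

count-suc-front : ∀ f n → count f (suc n) ≡ sucIf (f 0) (count (f ∘ suc) n)
count-suc-front f zero    = refl
count-suc-front f (suc n) = begin
  sucIf (f (suc n)) (count f (suc n))                   ≡⟨ cong (sucIf (f (suc n))) (count-suc-front f n) ⟩
  sucIf (f (suc n)) (sucIf (f 0) (count (f ∘ suc) n))   ≡⟨ sucIf-comm (f (suc n)) (f 0) _ ⟩
  sucIf (f 0) (count (f ∘ suc) (suc n))                 ∎
  where open ≡-Reasoning

length-filterᵇ-∷ : ∀ {A : Set} (p : A → Bool) x xs →
                   length (filterᵇ p (x ∷ xs)) ≡ sucIf (p x) (length (filterᵇ p xs))
length-filterᵇ-∷ p x xs with p x
... | true  = refl
... | false = refl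

length-filterᵇ-tabulate : ∀ {A : Set} {n} (h : Fin n → A) (p : A → Bool) (f : ℕ → Bool) →
                          (∀ i → p (h i) ≡ f (toℕ i)) → length (filterᵇ p (tabulate h)) ≡ count f n
length-filterᵇ-tabulate {n = zero}  h p f p∘h≗f = refl
length-filterᵇ-tabulate {n = suc n} h p f p∘h≗f = begin
  length (filterᵇ p (tabulate h))                                ≡⟨ length-filterᵇ-∷ p (h Fin.zero) _ ⟩
  sucIf (p (h Fin.zero)) (length (filterᵇ p (tabulate (h ∘ Fin.suc))))
    ≡⟨ cong₂ sucIf (p∘h≗f Fin.zero) (length-filterᵇ-tabulate (h ∘ Fin.suc) p (f ∘ suc) (p∘h≗f ∘ Fin.suc)) ⟩
  sucIf (f 0) (count (f ∘ suc) n)                                ≡⟨ count-suc-front f n ⟨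
  count f (suc n)                                                ∎
  where open ≡-Reasoning

length-below : ∀ n f → length (below n f) ≡ count f n
length-below n f = length-filterᵇ-tabulate {n = n} id (f ∘ toℕ) f (λ _ → refl)

∈-below : ∀ {n f} {x : Fin n} → T (f (toℕ x)) → x ∈ below n f
∈-below {n} {f} {x} fx = ∈-filter⁺ (λ (y : Fin n) → T? (f (toℕ y))) (∈-allFin x) fx

unique-below : ∀ n f → Unique (below n f)
unique-below n f = filter⁺ (λ (x : Fin n) → T? (f (toℕ x))) (allFin⁺ n)

∃Selected : ℕ → (ℕ → Bool) → (ℕ → Set) → Set
∃Selected n f P = ∃ λ c → c < n × T (f c) × P c

∃Selected-map : ∀ {n f} {P Q : ℕ → Set} → (∀ {c} → P c → Q c) → ∃Selected n f P → ∃Selected n f Q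
∃Selected-map g = Product.map₂ (Product.map₂ (Product.map₂ g))

select : ∀ {n f} {P : ℕ → Set} → ∃Selected n f P → ∃ λ (x : Fin n) → x ∈ below n f × P (toℕ x)
select {n} {f} {P} (c , c<n , fc , pc) =
  fromℕ< c<n , ∈-below {n} {f} (subst (T ∘ f) (sym (toℕ-fromℕ< c<n)) fc) , subst P (sym (toℕ-fromℕ< c<n)) pc

Distinguishes : (ℕ → ℕ → Set) → ℕ → ℕ → ℕ → Set
Distinguishes R i j c = R i c × ¬ R j c ⊎ ¬ R i c × R j c

distinguishes-sym : ∀ {R i j c} → Distinguishes R i j c → Distinguishes R j i c
distinguishes-sym (inj₁ (ric , ¬rjc)) = inj₂ (¬rjc , ric)
distinguishes-sym (inj₂ (¬ric , rjc)) = inj₁ (rjc , ¬ric)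

distinguishes⇒≢ : ∀ {R} (R? : Decidable R) {i j c} → Distinguishes R i j c → does (R? i c) ≢ does (R? j c)
distinguishes⇒≢ R? {i} {j} {c} (inj₁ (ric , ¬rjc)) rewrite dec-true (R? i c) ric | dec-false (R? j c) ¬rjc = λ ()
distinguishes⇒≢ R? {i} {j} {c} (inj₂ (¬ric , rjc)) rewrite dec-false (R? i c) ¬ric | dec-true (R? j c) rjc = λ ()

ℕGraph-ldSet : ∀ {n R} (R? : Decidable R) (f : ℕ → Bool) →
               (∀ i → i < n → ¬ T (f i) → ∃Selected n f (R i)) →
               (∀ i j → i < n → j < n → i ≢ j → ∃Selected n f (Distinguishes R i j)) →
               γLD≤ (Mycielski (ℕGraph n R?)) (suc (count f n))
ℕGraph-ldSet {n} R? f dominating locating =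
  subst (γLD≤ (Mycielski (ℕGraph n R?)) ∘ suc) (length-below n f)
        (mycielski-ldSet (ℕGraph n R?) (unique-below n f) dominates separates)
  where
  dominates : Dominates (ℕGraph n R?) (below n f)
  dominates x with T? (f (toℕ x))
  ... | yes fx = inj₁ (∈-below {n} {f} fx)
  ... | no ¬fx = let c , c∈ , xc = select (dominating (toℕ x) (toℕ<n x) ¬fx) in
                 inj₂ (c , c∈ , dec-true (R? _ _) xc)

  separates : Separates (ℕGraph n R?) (below n f)
  separates x y x≢y =
    let c , c∈ , d = select (locating (toℕ x) (toℕ y) (toℕ<n x) (toℕ<n y) (x≢y ∘ toℕ-injective)) in
    c , c∈ , distinguishes⇒≢ R? d

module _ {n R} (R? : Decidable R) (f : ℕ → Bool) (v : ℕ)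
         (neighbour : ∀ i → i < n → i ≢ v → ∃Selected n f (R i)) where

  dominating-by-neighbours : T (f v) → ∀ i → i < n → ¬ T (f i) → ∃Selected n f (R i)
  dominating-by-neighbours fv i i<n ¬fi = neighbour i i<n (λ { refl → ¬fi fv })

  module _ (common : ∀ {i j c} → i < n → j < n → i ≢ j → T (f c) → R i c → R j c →
                     ∃Selected n f (Distinguishes R i j)) where

    -- A selected neighbour of i either misses j or is a common neighbour of i and j.
    private
      locating-from-neighbour : ∀ {i j} → i ≢ v → i < n → j < n → i ≢ j →
                                ∃Selected n f (Distinguishes R i j)
      locating-from-neighbour {i} {j} i≢v i<n j<n i≢j with neighbour i i<n i≢v
      ... | c , c<n , fc , ric with R? j c
      ...   | no ¬rjc = c , c<n , fc , inj₁ (ric , ¬rjc)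
      ...   | yes rjc = common i<n j<n i≢j fc ric rjc

    locating-by-neighbours : ∀ i j → i < n → j < n → i ≢ j → ∃Selected n f (Distinguishes R i j)
    locating-by-neighbours i j i<n j<n i≢j with i ≟ v
    ... | no i≢v   = locating-from-neighbour i≢v i<n j<n i≢j
    ... | yes refl = ∃Selected-map (distinguishes-sym {R}) (locating-from-neighbour (i≢j ∘ sym) j<n i<n (i≢j ∘ sym))

distinguished-at-distance-two :
  ∀ {n R f i j} → (∀ a → 2 + a < n → ∃Selected n f (Distinguishes R a (2 + a))) →
  i < n → j < n → j ≡ 2 + i ⊎ i ≡ 2 + j → ∃Selected n f (Distinguishes R i j)
distinguished-at-distance-two {i = i} pair _   j<n (inj₁ refl) = pair i j<n
distinguished-at-distance-two {R = R} {j = j} pair i<n _ (inj₂ refl) =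
  ∃Selected-map (distinguishes-sym {R}) (pair j i<n)

-- Paths and cycles

PathEdge : ℕ → ℕ → Set
PathEdge i j = suc i ≡ j ⊎ suc j ≡ i

pathEdge? : Decidable PathEdge
pathEdge? i j = suc i ≟ j ⊎-dec suc j ≟ i

WrapEdge : ℕ → ℕ → ℕ → Set
WrapEdge n i j = i ≡ 0 × j ≡ n ∸ 1 ⊎ j ≡ 0 × i ≡ n ∸ 1

CycleEdge : ℕ → ℕ → ℕ → Set
CycleEdge n i j = suc i ≡ j ⊎ suc j ≡ i ⊎ WrapEdge n i j

cycleEdge? : ∀ n → Decidable (CycleEdge n)
cycleEdge? n i j = suc i ≟ j ⊎-dec suc j ≟ i ⊎-dec (i ≟ 0 ×-dec j ≟ n ∸ 1 ⊎-dec j ≟ 0 ×-dec i ≟ n ∸ 1)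

-- P n and C n are definitionally ℕGraph n pathEdge? and ℕGraph n (cycleEdge? n), since _≡ᵇ_ is does ∘ _≟_.

pathEdge⇒cycleEdge : ∀ {n i j} → PathEdge i j → CycleEdge n i j
pathEdge⇒cycleEdge (inj₁ e) = inj₁ e
pathEdge⇒cycleEdge (inj₂ e) = inj₂ (inj₁ e)

cycleEdge-split : ∀ {n i j} → CycleEdge n i j → PathEdge i j ⊎ WrapEdge n i j
cycleEdge-split (inj₁ e)        = inj₁ (inj₁ e)
cycleEdge-split (inj₂ (inj₁ e)) = inj₁ (inj₂ e)
cycleEdge-split (inj₂ (inj₂ w)) = inj₂ w

¬cycleEdge : ∀ {n i j} → ¬ PathEdge i j → ¬ WrapEdge n i j → ¬ CycleEdge n i j
¬cycleEdge {n} ¬p ¬w = Sum.[ ¬p , ¬w ] ∘ cycleEdge-split {n}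

cycleEdge-at : ∀ {n i c} → c ≢ 0 → CycleEdge n i c → PathEdge i c ⊎ i ≡ 0 × c ≡ n ∸ 1
cycleEdge-at {n} c≢0 e with cycleEdge-split {n} e
... | inj₁ p                = inj₁ p
... | inj₂ (inj₁ w)         = inj₂ w
... | inj₂ (inj₂ (c≡0 , _)) = ⊥-elim (c≢0 c≡0)

cycle-distinguishes : ∀ {n i j c} → ¬ WrapEdge n i c → ¬ WrapEdge n j c →
                      Distinguishes PathEdge i j c → Distinguishes (CycleEdge n) i j c
cycle-distinguishes {n} ¬wi ¬wj =
  Sum.map (Product.map (pathEdge⇒cycleEdge {n}) (λ ¬p → ¬cycleEdge {n} ¬p ¬wj))
          (Product.map (λ ¬p → ¬cycleEdge {n} ¬p ¬wi) (pathEdge⇒cycleEdge {n}))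

common-path-neighbour : ∀ {i j c} → PathEdge i c → PathEdge j c → i ≢ j → j ≡ 2 + i ⊎ i ≡ 2 + j
common-path-neighbour (inj₁ refl) (inj₁ refl) i≢j = ⊥-elim (i≢j refl)
common-path-neighbour (inj₁ refl) (inj₂ refl) _   = inj₁ refl
common-path-neighbour (inj₂ refl) (inj₁ refl) _   = inj₂ refl
common-path-neighbour (inj₂ refl) (inj₂ refl) i≢j = ⊥-elim (i≢j refl)

Flanks : ℕ → ℕ → Set
Flanks a q = q ≡ 3 + a ⊎ suc q ≡ a

flank-distinguishes : ∀ {a q} → Flanks a q → Distinguishes PathEdge a (2 + a) q
flank-distinguishes (inj₁ refl) = inj₂ ((λ { (inj₁ ()) ; (inj₂ ()) }) , inj₁ refl)
flank-distinguishes (inj₂ refl) = inj₁ (inj₂ refl , λ { (inj₁ ()) ; (inj₂ ()) })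

cycle-flank-distinguishes : ∀ {n a q} → 5 ≤ n → q ≢ 0 → Flanks a q → Distinguishes (CycleEdge n) a (2 + a) q
cycle-flank-distinguishes {n} (s≤s (s≤s (s≤s (s≤s (s≤s _))))) _ fl@(inj₁ refl) =
  cycle-distinguishes {n} (λ { (inj₁ (refl , ())) ; (inj₂ (() , _)) }) (λ { (inj₁ (() , _)) ; (inj₂ (() , _)) })
                      (flank-distinguishes fl)
cycle-flank-distinguishes {n} _ q≢0 fl@(inj₂ refl) =
  cycle-distinguishes {n} (λ { (inj₁ (() , _)) ; (inj₂ (q≡0 , _)) → q≢0 q≡0 })
                      (λ { (inj₁ (() , _)) ; (inj₂ (q≡0 , _)) → q≢0 q≡0 })
                      (flank-distinguishes fl)

-- The selected set S n

data Residue : Set where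
  r₀ r₁ r₂ : Residue

next : Residue → Residue
next r₀ = r₁
next r₁ = r₂
next r₂ = r₀

residue : ℕ → Residue
residue zero    = r₀
residue (suc i) = next (residue i)

periodic : ℕ → Bool
periodic zero    = false
periodic (suc i) with residue (suc i)
... | r₂ = false
... | _  = true

extraVertexFor : Residue → ℕ → ℕ
extraVertexFor r₀ n = n ∸ 4
extraVertexFor r₁ n = n ∸ 2
extraVertexFor r₂ n = n

extraVertex : ℕ → ℕ
extraVertex n = extraVertexFor (residue n) n

-- For n ≡ 2 (mod 3) the extra vertex is n itself, which lies outside the graph: nothing is added.
S : ℕ → ℕ → Bool
S n i = periodic i ∨ (i ≡ᵇ extraVertex n)

∣S∣ : ℕ → ℕ
∣S∣ n = count (S n) n

extra-selected : ∀ {n i r} → residue n ≡ r → extraVertexFor r n ≡ i → T (S n i)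
extra-selected {n} refl refl =
  Equivalence.from (Bool.T-∨ {periodic (extraVertex n)}) (inj₂ (≡⇒≡ᵇ (extraVertex n) _ refl))

selected-or-r₂ : ∀ {n} i → i ≢ 0 → T (S n i) ⊎ residue i ≡ r₂
selected-or-r₂ zero    i≢0 = ⊥-elim (i≢0 refl)
selected-or-r₂ (suc i) _ with residue (suc i)
... | r₀ = inj₁ _
... | r₁ = inj₁ _
... | r₂ = inj₂ refl

selected-periodic : ∀ {n i r} → i ≢ 0 → residue i ≡ r → r ≢ r₂ → T (S n i)
selected-periodic {n} {i} i≢0 refl r≢r₂ = Sum.[ id , ⊥-elim ∘ r≢r₂ ] (selected-or-r₂ {n} i i≢0)

extraVertex-positive : ∀ {n} → 5 ≤ n → ∀ r → 0 < extraVertexFor r n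
extraVertex-positive (s≤s (s≤s (s≤s (s≤s (s≤s _))))) r₀ = s≤s z≤n
extraVertex-positive (s≤s (s≤s (s≤s (s≤s (s≤s _))))) r₁ = s≤s z≤n
extraVertex-positive (s≤s (s≤s (s≤s (s≤s (s≤s _))))) r₂ = s≤s z≤n

selected⇒≢0 : ∀ {n c} → 5 ≤ n → T (S n c) → c ≢ 0
selected⇒≢0 {n} 5≤n s₀ refl = <⇒≢ (extraVertex-positive 5≤n (residue n)) (≡ᵇ⇒≡ 0 (extraVertex n) s₀)

selected-neighbour : ∀ {n} → 2 ≤ n → ∀ i → i < n → i ≢ 1 → ∃Selected n (S n) (PathEdge i)
selected-neighbour 2≤n zero _ _ = 1 , 2≤n , _ , inj₁ refl
selected-neighbour {n} _ (suc i) i+1<n i+1≢1 with selected-or-r₂ {n} i (i+1≢1 ∘ cong suc)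
... | inj₁ sᵢ = i , <-trans (n<1+n i) i+1<n , sᵢ , inj₂ refl
... | inj₂ ρ with 2 + i <? n
...   | yes i+2<n = 2 + i , i+2<n , selected-periodic {n} {2 + i} (λ ()) (cong (next ∘ next) ρ) (λ ()) , inj₁ refl
...   | no i+2≮n with refl ← ≤-antisym i+1<n (≮⇒≥ i+2≮n) =
  i , <-trans (n<1+n i) i+1<n , extra-selected {2 + i} (cong (next ∘ next) ρ) refl , inj₂ refl

selected-flank : ∀ {n} → 5 ≤ n → ∀ a → 2 + a < n → ∃Selected n (S n) (Flanks a)
selected-flank 5≤n zero _ = 3 , ≤-trans (n≤1+n 4) 5≤n , _ , inj₁ refl
selected-flank 5≤n (suc zero) _ = 4 , 5≤n , _ , inj₁ refl
selected-flank {n} _ (suc (suc b)) b+4<n with selected-or-r₂ {n} (suc b) (λ ())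
... | inj₁ sᵦ = suc b , <-trans (s≤s (m≤n+m (suc b) 2)) b+4<n , sᵦ , inj₂ refl
... | inj₂ ρ with 5 + b <? n
...   | yes b+5<n = 5 + b , b+5<n , selected-periodic {n} {5 + b} (λ ()) (cong (next ∘ next ∘ next ∘ next) ρ) (λ ()) , inj₁ refl
...   | no b+5≮n with refl ← ≤-antisym b+4<n (≮⇒≥ b+5≮n) =
  suc b , <-trans (s≤s (m≤n+m (suc b) 2)) b+4<n ,
  extra-selected {5 + b} (cong (next ∘ next ∘ next ∘ next) ρ) refl , inj₂ refl

path-ldSet : ∀ {n} → 5 ≤ n → γLD≤ (Mycielski (P n)) (suc (∣S∣ n))
path-ldSet {n} 5≤n =
  ℕGraph-ldSet pathEdge? (S n) (dominating-by-neighbours pathEdge? (S n) 1 nbr _)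
                               (locating-by-neighbours pathEdge? (S n) 1 nbr common)
  where
  nbr : ∀ i → i < n → i ≢ 1 → ∃Selected n (S n) (PathEdge i)
  nbr = selected-neighbour (≤-trans (s≤s (s≤s z≤n)) 5≤n)

  common : ∀ {i j c} → i < n → j < n → i ≢ j → T (S n c) → PathEdge i c → PathEdge j c →
           ∃Selected n (S n) (Distinguishes PathEdge i j)
  common i<n j<n i≢j _ ic jc =
    distinguished-at-distance-two (λ a a+2<n → ∃Selected-map flank-distinguishes (selected-flank 5≤n a a+2<n))
                                  i<n j<n (common-path-neighbour ic jc i≢j)

distinguished-across-wrap : ∀ {n j} → 5 ≤ n → j < n → PathEdge j (n ∸ 1) → ∃Selected n (S n) (Distinguishes (CycleEdge n) 0 j)
distinguished-across-wrap {n} (s≤s (s≤s (s≤s (s≤s (s≤s _))))) _ (inj₁ refl) =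
  1 , s≤s (s≤s z≤n) , _ ,
  inj₁ (inj₁ refl , ¬cycleEdge {n} (λ { (inj₁ ()) ; (inj₂ ()) }) (λ { (inj₁ (() , _)) ; (inj₂ (() , _)) }))
distinguished-across-wrap (s≤s (s≤s (s≤s (s≤s (s≤s _))))) j<n (inj₂ refl) = ⊥-elim (<-irrefl refl j<n)

cycle-ldSet : ∀ {n} → 5 ≤ n → γLD≤ (Mycielski (C n)) (suc (∣S∣ n))
cycle-ldSet {n} 5≤n =
  ℕGraph-ldSet (cycleEdge? n) (S n) (dominating-by-neighbours (cycleEdge? n) (S n) 1 nbr _)
                                    (locating-by-neighbours (cycleEdge? n) (S n) 1 nbr common)
  where
  nbr : ∀ i → i < n → i ≢ 1 → ∃Selected n (S n) (CycleEdge n i)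
  nbr i i<n i≢1 = ∃Selected-map (pathEdge⇒cycleEdge {n}) (selected-neighbour (≤-trans (s≤s (s≤s z≤n)) 5≤n) i i<n i≢1)

  at-distance-two : ∀ a → 2 + a < n → ∃Selected n (S n) (Distinguishes (CycleEdge n) a (2 + a))
  at-distance-two a a+2<n =
    let q , q<n , s_q , q-flanks = selected-flank 5≤n a a+2<n in
    q , q<n , s_q , cycle-flank-distinguishes 5≤n (selected⇒≢0 5≤n s_q) q-flanks

  common : ∀ {i j c} → i < n → j < n → i ≢ j → T (S n c) → CycleEdge n i c → CycleEdge n j c →
           ∃Selected n (S n) (Distinguishes (CycleEdge n) i j)
  common i<n j<n i≢j s_c ic jc with cycleEdge-at {n} (selected⇒≢0 5≤n s_c) ic | cycleEdge-at {n} (selected⇒≢0 5≤n s_c) jc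
  ... | inj₁ ic′ | inj₁ jc′ = distinguished-at-distance-two at-distance-two i<n j<n (common-path-neighbour ic′ jc′ i≢j)
  ... | inj₂ (refl , refl) | inj₁ jc′ = distinguished-across-wrap 5≤n j<n jc′
  ... | inj₁ ic′ | inj₂ (refl , refl) = ∃Selected-map (distinguishes-sym {CycleEdge n}) (distinguished-across-wrap 5≤n i<n ic′)
  ... | inj₂ (refl , _) | inj₂ (refl , _) = ⊥-elim (i≢j refl)

-- Counting

count-∨ : ∀ f g n → count (λ i → f i ∨ g i) n ≤ count f n + count g n
count-∨ f g zero = z≤n
count-∨ f g (suc n) with f n | g n | count-∨ f g n
... | true  | true  | ih = s≤s (≤-trans ih (+-monoʳ-≤ (count f n) (n≤1+n _)))
... | true  | false | ih = s≤s ih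
... | false | true  | ih = ≤-trans (s≤s ih) (≤-reflexive (sym (+-suc (count f n) _)))
... | false | false | ih = ih

≡ᵇ-true : ∀ {m n} → m ≡ n → (m ≡ᵇ n) ≡ true
≡ᵇ-true {m} {n} = dec-true (m ≟ n)

≡ᵇ-false : ∀ {m n} → m ≢ n → (m ≡ᵇ n) ≡ false
≡ᵇ-false {m} {n} = dec-false (m ≟ n)

count-≡ᵇ-≡0 : ∀ e n → n ≤ e → count (_≡ᵇ e) n ≡ 0
count-≡ᵇ-≡0 e zero    _   = refl
count-≡ᵇ-≡0 e (suc n) n<e rewrite ≡ᵇ-false (<⇒≢ n<e) = count-≡ᵇ-≡0 e n (<⇒≤ n<e)

count-≡ᵇ-≤1 : ∀ e n → count (_≡ᵇ e) n ≤ 1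
count-≡ᵇ-≤1 e zero = z≤n
count-≡ᵇ-≤1 e (suc n) with n ≟ e
... | yes refl rewrite ≡ᵇ-true {n} refl | count-≡ᵇ-≡0 n n ≤-refl = ≤-refl
... | no n≢e   rewrite ≡ᵇ-false n≢e = count-≡ᵇ-≤1 e n

residue-3* : ∀ k → residue (3 * k) ≡ r₀
residue-3* zero    = refl
residue-3* (suc k) = trans (cong residue (*-suc 3 k)) (cong (next ∘ next ∘ next) (residue-3* k))

count-periodic-block : ∀ {m} → residue m ≡ r₀ →
                       count periodic (2 + m) ≡ 1 + count periodic (1 + m) ×
                       count periodic (3 + m) ≡ 1 + count periodic (1 + m) ×
                       count periodic (4 + m) ≡ 2 + count periodic (1 + m)
count-periodic-block ρ rewrite ρ = refl , refl , refl

count-periodic : ∀ k → count periodic (1 + 3 * k) ≡ 2 * k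
count-periodic zero    = refl
count-periodic (suc k) = begin
  count periodic (1 + 3 * suc k)  ≡⟨ cong (count periodic ∘ suc) (*-suc 3 k) ⟩
  count periodic (4 + 3 * k)      ≡⟨ proj₂ (proj₂ (count-periodic-block {3 * k} (residue-3* k))) ⟩
  2 + count periodic (1 + 3 * k)  ≡⟨ cong (2 +_) (count-periodic k) ⟩
  2 + 2 * k                       ≡⟨ *-suc 2 k ⟨
  2 * suc k                       ∎
  where open ≡-Reasoning

∣S∣-split : ∀ n → ∣S∣ n ≤ count periodic n + count (_≡ᵇ extraVertex n) n
∣S∣-split n = count-∨ periodic (_≡ᵇ extraVertex n) n

∣S∣-3k+1 : ∀ k → ∣S∣ (1 + 3 * k) ≤ 1 + 2 * k
∣S∣-3k+1 k = begin
  ∣S∣ n                                           ≤⟨ ∣S∣-split n ⟩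
  count periodic n + count (_≡ᵇ extraVertex n) n  ≤⟨ +-mono-≤ (≤-reflexive (count-periodic k))
                                                               (count-≡ᵇ-≤1 (extraVertex n) n) ⟩
  2 * k + 1                                       ≡⟨ +-comm (2 * k) 1 ⟩
  1 + 2 * k                                       ∎
  where
  open ≤-Reasoning
  n = 1 + 3 * k

∣S∣-3k+2 : ∀ k → ∣S∣ (2 + 3 * k) ≤ 1 + 2 * k
∣S∣-3k+2 k = begin
  ∣S∣ n                                           ≤⟨ ∣S∣-split n ⟩
  count periodic n + count (_≡ᵇ extraVertex n) n  ≡⟨ cong₂ _+_ (proj₁ (count-periodic-block {3 * k} ρ)) no-extra ⟩
  1 + count periodic (1 + 3 * k) + 0              ≡⟨ +-identityʳ _ ⟩
  1 + count periodic (1 + 3 * k)                  ≡⟨ cong suc (count-periodic k) ⟩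
  1 + 2 * k                                       ∎
  where
  open ≤-Reasoning
  n = 2 + 3 * k
  ρ = residue-3* k
  no-extra : count (_≡ᵇ extraVertex n) n ≡ 0
  no-extra = count-≡ᵇ-≡0 _ _ (≤-reflexive (sym (cong (λ r → extraVertexFor r n) (cong (next ∘ next) ρ))))

∣S∣-3k+3 : ∀ k → ∣S∣ (3 + 3 * k) ≤ 2 + 2 * k
∣S∣-3k+3 k = begin
  ∣S∣ n                                           ≤⟨ ∣S∣-split n ⟩
  count periodic n + count (_≡ᵇ extraVertex n) n  ≤⟨ +-mono-≤ (≤-reflexive (proj₁ (proj₂ (count-periodic-block {3 * k} (residue-3* k)))))
                                                               (count-≡ᵇ-≤1 (extraVertex n) n) ⟩
  1 + count periodic (1 + 3 * k) + 1              ≡⟨ cong (λ x → 1 + x + 1) (count-periodic k) ⟩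
  1 + 2 * k + 1                                   ≡⟨ +-comm (1 + 2 * k) 1 ⟩
  2 + 2 * k                                       ∎
  where
  open ≤-Reasoning
  n = 3 + 3 * k

∣S∣<pathBound : ∀ k r → 1 ≤ k → r ≤ 2 → ∣S∣ (3 * k + r) < pathBound k r
∣S∣<pathBound (suc k) 0 _ _ =
  subst (λ n → ∣S∣ n < pathBound (suc k) 0) (sym (trans (+-identityʳ _) (*-suc 3 k)))
        (≤-trans (s≤s (∣S∣-3k+3 k)) (≤-reflexive (sym (trans (cong (_+ 1) (*-suc 2 k)) (+-comm (2 + 2 * k) 1)))))
∣S∣<pathBound k 1 _ _ =
  subst (λ n → ∣S∣ n < pathBound k 1) (+-comm 1 (3 * k))
        (≤-trans (s≤s (∣S∣-3k+1 k)) (≤-reflexive (+-comm 2 (2 * k))))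
∣S∣<pathBound k 2 _ _ =
  subst (λ n → ∣S∣ n < pathBound k 2) (+-comm 2 (3 * k))
        (≤-trans (s≤s (∣S∣-3k+2 k)) (≤-reflexive (+-comm 2 (2 * k))))
∣S∣<pathBound _ (suc (suc (suc _))) _ (s≤s (s≤s ()))

n≡3[n/3]+n%3 : ∀ n → n ≡ 3 * (n / 3) + n % 3
n≡3[n/3]+n%3 n = trans (m≡m%n+[m/n]*n n 3) (trans (+-comm (n % 3) _) (cong (_+ n % 3) (*-comm (n / 3) 3)))

n∸n/3≡2[n/3]+n%3 : ∀ n → n ∸ n / 3 ≡ 2 * (n / 3) + n % 3
n∸n/3≡2[n/3]+n%3 n = begin
  n ∸ k                     ≡⟨ cong (_∸ k) (n≡3[n/3]+n%3 n) ⟩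
  (k + 2 * k) + r ∸ k       ≡⟨ cong (_∸ k) (+-assoc k (2 * k) r) ⟩
  k + (2 * k + r) ∸ k       ≡⟨ m+n∸m≡n k (2 * k + r) ⟩
  2 * k + r                 ∎
  where
  open ≡-Reasoning
  k = n / 3
  r = n % 3

pathBound≤ : ∀ k r → pathBound k r ≤ 2 * k + r + 1
pathBound≤ k zero    = ≤-reflexive (cong (_+ 1) (sym (+-identityʳ (2 * k))))
pathBound≤ k (suc r) = ≤-trans (≤-reflexive (sym (+-assoc (2 * k) 1 1)))
                               (+-monoˡ-≤ 1 (+-monoʳ-≤ (2 * k) (s≤s z≤n)))

2[n/6]≤n/3 : ∀ n → 2 * (n / 6) ≤ n / 3
2[n/6]≤n/3 n = begin
  2 * (n / 6)      ≡⟨ cong (2 *_) (m/n/o≡m/[n*o] n 3 2) ⟨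
  2 * (n / 3 / 2)  ≡⟨ *-comm 2 (n / 3 / 2) ⟩
  n / 3 / 2 * 2    ≤⟨ m/n*n≤m (n / 3) 2 ⟩
  n / 3            ∎
  where open ≤-Reasoning

n∸n/3+1≤cycleBound : ∀ n → n ∸ n / 3 + 1 ≤ cycleBound n
n∸n/3+1≤cycleBound n with n % 2
... | zero  = +-monoˡ-≤ 1 (∸-monoʳ-≤ n (2[n/6]≤n/3 n))
... | suc _ = ≤-refl

pathBound≤cycleBound : ∀ n → pathBound (n / 3) (n % 3) ≤ cycleBound n
pathBound≤cycleBound n = begin
  pathBound (n / 3) (n % 3)    ≤⟨ pathBound≤ (n / 3) (n % 3) ⟩
  2 * (n / 3) + n % 3 + 1      ≡⟨ cong (_+ 1) (n∸n/3≡2[n/3]+n%3 n) ⟨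
  n ∸ n / 3 + 1                ≤⟨ n∸n/3+1≤cycleBound n ⟩
  cycleBound n                 ∎
  where open ≤-Reasoning

∣S∣<pathBound[n/3] : ∀ n → 3 ≤ n → ∣S∣ n < pathBound (n / 3) (n % 3)
∣S∣<pathBound[n/3] n 3≤n =
  subst (λ m → ∣S∣ m < pathBound (n / 3) (n % 3)) (sym (n≡3[n/3]+n%3 n))
        (∣S∣<pathBound (n / 3) (n % 3) (m≥n⇒m/n>0 3≤n) (≤-pred (m%n<n n 3)))

-- Deciding IsLDSet on a finite graph

module _ (G : Graph) (_≟_ : DecidableEquality (Vtx G)) {vs : List (Vtx G)} (complete : ∀ x → x ∈ vs) where

  private
    ∀? : {P : Vtx G → Set} → (∀ x → Dec (P x)) → Dec (∀ x → P x)
    ∀? P? = map′ (λ all x → All.lookup all (complete x)) (λ p → All.tabulate (λ {x} _ → p x)) (All.all? P? vs)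

    ∃∈? : {P : Vtx G → Set} (xs : List (Vtx G)) → (∀ x → Dec (P x)) → Dec (∃ λ x → x ∈ xs × P x)
    ∃∈? xs P? = map′ find (λ (_ , x∈ , px) → lose x∈ px) (any? P? xs)

    open DecMembership _≟_ using (_∈?_)

  isLDSet? : ∀ Cs → Dec (IsLDSet G Cs)
  isLDSet? Cs =
    ∀? (λ x → x ∈? Cs ⊎-dec ∃∈? Cs (λ c → adj G x c Bool.≟ true))
    ×-dec
    ∀? (λ x → ∀? (λ y → ¬? (x ∈? Cs) →-dec ¬? (y ∈? Cs) →-dec ¬? (x ≟ y) →-dec
                        ∃∈? Cs (λ c → ¬? (adj G x c Bool.≟ adj G y c))))

≟-MVtx : ∀ {V} → DecidableEquality V → DecidableEquality (MVtx V)
≟-MVtx _≟_ (orig x)   (orig y)   = map′ (cong orig) orig-injective (x ≟ y)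
≟-MVtx _≟_ (shadow x) (shadow y) = map′ (cong shadow) (λ { refl → refl }) (x ≟ y)
≟-MVtx _≟_ apex       apex       = yes refl
≟-MVtx _≟_ (orig _)   (shadow _) = no λ ()
≟-MVtx _≟_ (orig _)   apex       = no λ ()
≟-MVtx _≟_ (shadow _) (orig _)   = no λ ()
≟-MVtx _≟_ (shadow _) apex       = no λ ()
≟-MVtx _≟_ apex       (orig _)   = no λ ()
≟-MVtx _≟_ apex       (shadow _) = no λ ()

mycielskiVertices : ∀ n → List (MVtx (Fin n))
mycielskiVertices n = map orig (allFin n) ++ map shadow (allFin n) ++ apex ∷ []

∈-mycielskiVertices : ∀ {n} (x : MVtx (Fin n)) → x ∈ mycielskiVertices n
∈-mycielskiVertices         (orig i)   = ∈-++⁺ˡ (∈-map⁺ orig (∈-allFin i))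
∈-mycielskiVertices {n}     (shadow i) = ∈-++⁺ʳ (map orig (allFin n)) (∈-++⁺ˡ (∈-map⁺ shadow (∈-allFin i)))
∈-mycielskiVertices {n}     apex       = ∈-++⁺ʳ (map orig (allFin n)) (∈-++⁺ʳ (map shadow (allFin n)) (here refl))

mycielski-cycle-ldSet? : ∀ n (Cs : List (MVtx (Fin n))) → Dec (Unique Cs × IsLDSet (Mycielski (C n)) Cs)
mycielski-cycle-ldSet? n Cs =
  unique? (≟-MVtx Fin._≟_) Cs ×-dec isLDSet? (Mycielski (C n)) (≟-MVtx Fin._≟_) ∈-mycielskiVertices Cs

M[C₃]-ldSet : γLD≤ (Mycielski (C 3)) (cycleBound 3)
M[C₃]-ldSet = let unique , ldSet = from-yes (mycielski-cycle-ldSet? 3 Cs) in Cs , unique , ldSet , ≤-refl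
  where Cs = apex ∷ orig (# 1) ∷ orig (# 2) ∷ []

-- In C₄ the vertices 0 and 2 have the same neighbourhood, so here the apex is left out.
M[C₄]-ldSet : γLD≤ (Mycielski (C 4)) (cycleBound 4)
M[C₄]-ldSet = let unique , ldSet = from-yes (mycielski-cycle-ldSet? 4 Cs) in Cs , unique , ldSet , ≤-refl
  where Cs = orig (# 0) ∷ orig (# 1) ∷ orig (# 2) ∷ shadow (# 0) ∷ shadow (# 1) ∷ []

theorem7 : ((k r : ℕ) → 2 ≤ k → r ≤ 2 → γLD≤ (Mycielski (P (3 * k + r))) (pathBound k r))
           × ((n : ℕ) → 3 ≤ n → γLD≤ (Mycielski (C n)) (cycleBound n))
theorem7 = path , cycle
  where
  path : (k r : ℕ) → 2 ≤ k → r ≤ 2 → γLD≤ (Mycielski (P (3 * k + r))) (pathBound k r)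
  path k r 2≤k r≤2 =
    γLD≤-weaken (∣S∣<pathBound k r (≤-trans (s≤s z≤n) 2≤k) r≤2)
                (path-ldSet (≤-trans (n≤1+n 5) (≤-trans (*-monoʳ-≤ 3 2≤k) (m≤m+n (3 * k) r))))

  cycle : (n : ℕ) → 3 ≤ n → γLD≤ (Mycielski (C n)) (cycleBound n)
  cycle 0 ()
  cycle 1 (s≤s ())
  cycle 2 (s≤s (s≤s ()))
  cycle 3 _ = M[C₃]-ldSet
  cycle 4 _ = M[C₄]-ldSet
  cycle n@(suc (suc (suc (suc (suc _))))) 3≤n =
    γLD≤-weaken (≤-trans (∣S∣<pathBound[n/3] n 3≤n) (pathBound≤cycleBound n)) (cycle-ldSet (s≤s (s≤s (s≤s (s≤s (s≤s z≤n))))))
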